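{- For every integer $n\ge 5$, $\overrightarrow{\beta}(K_n,1)=n-3$, where $K_n$ is the complete graph on $n$ vertices.
   Context: Firefighting on oriented graphs: an orientation $\overrightarrow{G}$ of a finite simple graph $G$ replaces each edge $uv$ by exactly one of the arcs $\overrightarrow{uv}$, $\overrightarrow{vu}$. Let $f\ge 1$ be an integer. A fire breaks out at a vertex $v$ at time $1$ ($v$ burns). At the end of each time unit, the firefighters permanently protect up to $f$ vertices that are neither burning nor already protected. At the next time unit, every vertex that is neither burning nor protected and is an out-neighbour of a burning vertex starts to burn. The process ends when no new vertex can burn. $\beta(\overrightarrow{G},f)$ is the maximum, over all starting vertices $v$, of the minimum, over all protection strategies, of the number of vertices that burn. $\overrightarrow{\beta}(G,f)$ is the minimum of $\beta(\overrightarrow{G},f)$ over all orientations $\overrightarrow{G}$ of $G$. -}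

module Defs where

open import Data.Nat using (ℕ; zero; suc; _≤_; _∸_)
open import Data.Bool using (Bool; true; false; not; _∧_; _∨_; _xor_)
open import Data.Fin using (Fin; zero; suc)
open import Data.Fin.Properties using (_≟_)
open import Data.Fin.Subset using (Subset; ⁅_⁆; ⊥; _∪_; ∁; _⊆_; ∣_∣)
open import Data.Vec using (lookup; tabulate)
open import Data.Product using (_×_; _,_; proj₁; proj₂; Σ; ∃)
open import Relation.Binary.PropositionalEquality using (_≡_)
open import Relation.Nullary.Decidable using (⌊_⌋)

record Graph (n : ℕ) : Set where
  field
    adj     : Fin n → Fin n → Bool
    symm    : ∀ i j → adj i j ≡ adj j i
    irrefl  : ∀ i → adj i i ≡ false
open Graph public

-- A directed graph on Fin n: arc i j ≡ true means there is an arc i → j.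
Digraph : ℕ → Set
Digraph n = Fin n → Fin n → Bool

IsOrientation : ∀ {n} → Graph n → Digraph n → Set
IsOrientation G D =
  ∀ i j → (D i j ≡ true → adj G i j ≡ true)
        × (adj G i j ≡ true → (D i j xor D j i) ≡ true)

K : (n : ℕ) → Graph n
K n = record
  { adj    = λ i j → not ⌊ i ≟ j ⌋
  ; symm   = sym′
  ; irrefl = irr
  }
  where
  open import Relation.Binary.PropositionalEquality using (refl; sym)
  open import Relation.Nullary using (yes; no)
  sym′ : ∀ i j → not ⌊ i ≟ j ⌋ ≡ not ⌊ j ≟ i ⌋
  sym′ i j with i ≟ j | j ≟ i
  ... | yes _ | yes _ = refl
  ... | no _  | no _  = refl
  ... | yes p | no ¬q with ¬q (sym p)
  ... | ()
  sym′ i j | no ¬p | yes q with ¬p (sym q)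
  ... | ()
  irr : ∀ i → not ⌊ i ≟ i ⌋ ≡ false
  irr i with i ≟ i
  ... | yes _ = refl
  ... | no ¬p with ¬p refl
  ... | ()

anyFin : ∀ {n} → (Fin n → Bool) → Bool
anyFin {zero}  p = false
anyFin {suc n} p = p zero ∨ anyFin (λ i → p (suc i))

spread : ∀ {n} → Digraph n → (burning protected : Subset n) → Subset n
spread D B P =
  tabulate λ u → not (lookup P u) ∧ anyFin (λ w → lookup B w ∧ D w u)

-- A protection strategy: at the end of time unit k+1 the set σ k is protected.
-- (The game is deterministic, so a strategy is just a sequence of sets.)
Strategy : ℕ → Set
Strategy n = ℕ → Subset n

run : ∀ {n} → Digraph n → Fin n → Strategy n → ℕ → Subset n × Subset n
run D v σ zero    = ⁅ v ⁆ , ⊥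
run D v σ (suc k) =
  let B  = proj₁ (run D v σ k)
      P  = proj₂ (run D v σ k)
      P′ = P ∪ σ k
  in  (B ∪ spread D B P′) , P′

Valid : ∀ {n} → Digraph n → ℕ → Fin n → Strategy n → Set
Valid D f v σ =
  ∀ k → ∣ σ k ∣ ≤ f
      × σ k ⊆ ∁ (proj₁ (run D v σ k) ∪ proj₂ (run D v σ k))

-- Number of burnt vertices at the end of the process. After n rounds
-- no new vertex can burn (the burning set grows at every round until the
-- process stops, and it has at most n elements).
burnt : ∀ {n} → Digraph n → Fin n → Strategy n → ℕ
burnt {n} D v σ = ∣ proj₁ (run D v σ n) ∣

IsMinBurnt : ∀ {n} → Digraph n → ℕ → Fin n → ℕ → Set
IsMinBurnt D f v m =
  (Σ (Strategy _) λ σ → Valid D f v σ × burnt D v σ ≡ m)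
  × (∀ σ → Valid D f v σ → m ≤ burnt D v σ)

IsBeta : ∀ {n} → Digraph n → ℕ → ℕ → Set
IsBeta {n} D f b =
  (Σ (Fin n) λ v → IsMinBurnt D f v b)
  × (∀ v m → IsMinBurnt D f v m → m ≤ b)

IsOrientedBeta : ∀ {n} → Graph n → ℕ → ℕ → Set
IsOrientedBeta {n} G f b =
  (Σ (Digraph n) λ D → IsOrientation G D × IsBeta D f b)
  × (∀ D b′ → IsOrientation G D → IsBeta D f b′ → b ≤ b′)

module Submission where

-- The orientations of K n are the tournaments on n vertices, and the value is
-- pinned down by matching bounds.
-- * Lower bound, in every tournament: start the fire at a vertex v of maximum
--   out-degree.  After two rounds at most two vertices are protected, and any
--   vertex neither burning nor protected beats v and every out-neighbour of v
--   that caught fire in round one; an arc between two such vertices would give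
--   one of them a larger out-degree than v.  So at least n ∸ 3 vertices burn.
-- * Upper bound, in one tournament Tₘ on 5 + m vertices: the regular tournament
--   C₅ beating m transitively ordered sinks.  A fire at x in C₅ is contained by
--   protecting x + 2 and then x + 3, which also saves x + 4; a fire among the
--   sinks never leaves them.  Either way three vertices are saved.
-- Since β is a maximum of minima over strategies, the lower bound also needs an
-- optimal strategy at every vertex; it is built by backward induction over the
-- finitely many legal moves.

open import Defs
open import Data.Nat using (ℕ; zero; suc; _+_; _≤_; _∸_; z≤n; s≤s; _≤?_)
open import Data.Nat.Properties
  using (≤-refl; ≤-trans; ≤-reflexive; ≤-antisym; +-identityʳ; +-suc; +-comm;
         +-mono-≤; +-monoʳ-≤; +-monoˡ-≤; +-monoʳ-<; m≤n⇒m≤1+n; m∸n+n≡m; m+n∸n≡m;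
         m≤n+o⇒m∸n≤o; m+n≤o⇒m≤o∸n; 1+n≰n; module ≤-Reasoning)
open import Data.Bool using (Bool; true; false; not; _∧_; _∨_; _xor_)
open import Data.Bool.Properties using (∧-conicalˡ; ∧-conicalʳ; ¬-not; not-¬; ∨-zeroʳ) renaming (_≟_ to _≟ᵇ_)
open import Data.Fin using (Fin; zero; suc; fromℕ<; _↑ˡ_; splitAt; join)
open import Data.Fin.Properties
  using (suc-injective; _≟_; _<?_; <-cmp; <-irrefl; all?;
         ↑ˡ-injective; splitAt-↑ˡ; splitAt⁻¹-↑ˡ; join-splitAt)
open import Data.Fin.Subset
  using (Subset; outside; inside; _∈_; _∉_; ⁅_⁆; ⊥; _∪_; _∩_; ∁; _⊆_; ∣_∣)
open import Data.Fin.Subset.Properties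
  using (_∈?_; _⊆?_; ∉⊥; ⊥⊆; Empty-unique; x∈⁅x⁆; x∈⁅y⁆⇒x≡y; x∈p∪q⁺; x∈p∪q⁻;
         x∈p∩q⁺; x∈p∩q⁻; x∈∁p⇒x∉p; x∉p⇒x∈∁p; x∈p⇒x∉∁p; x∉∁p⇒x∈p; p⊆p∪q; p∪∁p≡⊤;
         p⊆q⇒∣p∣≤∣q∣; ∣p∣≤n; ∣⊥∣≡0; ∣⊤∣≡n; ∣⁅x⁆∣≡1)
open import Data.Vec using ([]; _∷_; here; there; lookup; tabulate)
open import Data.Vec.Properties using (lookup∘tabulate; []=⇒lookup; lookup⇒[]=)
open import Data.List using (List; []; _∷_; map; _++_; filter; allFin)
import Data.List.Relation.Unary.Any as Any
import Data.List.Relation.Unary.All as All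
open import Data.List.Relation.Unary.All.Properties using (all-filter)
open import Data.List.Membership.Propositional using () renaming (_∈_ to _∈ₗ_)
open import Data.List.Membership.Propositional.Properties
  using (∈-map⁺; ∈-++⁺ˡ; ∈-++⁺ʳ; ∈-filter⁺; ∈-allFin)
open import Data.List.Extrema.Nat using (argmin; f[argmin]≤f[xs]; argmin-all; argmax; f[xs]≤f[argmax])
open import Data.Product using (_×_; _,_; proj₁; proj₂; Σ; ∃)
open import Data.Sum using (_⊎_; inj₁; inj₂; [_,_])
import Data.Sum as Sum
open import Function using (_∘_)
open import Relation.Binary.PropositionalEquality
  using (_≡_; _≢_; refl; sym; trans; cong; cong₂; subst; module ≡-Reasoning)
open import Relation.Binary.Definitions using (tri<; tri≈; tri>)
open import Relation.Nullary using (contradiction; yes; no; does)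
open import Relation.Nullary.Decidable
  using (_×-dec_; _→-dec_; _⊎-dec_; ¬?; True; toWitness; dec-true; dec-false)
open import Relation.Unary using (Decidable)

-- Cardinalities of finite subsets

∣p∪q∣≤∣p∣+∣q∣ : ∀ {n} (p q : Subset n) → ∣ p ∪ q ∣ ≤ ∣ p ∣ + ∣ q ∣
∣p∪q∣≤∣p∣+∣q∣ []            []            = z≤n
∣p∪q∣≤∣p∣+∣q∣ (outside ∷ p) (outside ∷ q) = ∣p∪q∣≤∣p∣+∣q∣ p q
∣p∪q∣≤∣p∣+∣q∣ (outside ∷ p) (inside ∷ q)  =
  ≤-trans (s≤s (∣p∪q∣≤∣p∣+∣q∣ p q)) (≤-reflexive (sym (+-suc ∣ p ∣ ∣ q ∣)))
∣p∪q∣≤∣p∣+∣q∣ (inside ∷ p)  (outside ∷ q) = s≤s (∣p∪q∣≤∣p∣+∣q∣ p q)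
∣p∪q∣≤∣p∣+∣q∣ (inside ∷ p)  (inside ∷ q)  =
  s≤s (≤-trans (m≤n⇒m≤1+n (∣p∪q∣≤∣p∣+∣q∣ p q)) (≤-reflexive (sym (+-suc ∣ p ∣ ∣ q ∣))))

Disjoint : ∀ {n} → Subset n → Subset n → Set
Disjoint p q = ∀ {x} → x ∈ p → x ∉ q

disjoint-tail : ∀ {n} {s t} {p q : Subset n} → Disjoint (s ∷ p) (t ∷ q) → Disjoint p q
disjoint-tail d x∈p x∈q = d (there x∈p) (there x∈q)

disjoint-∣p∪q∣ : ∀ {n} (p q : Subset n) → Disjoint p q → ∣ p ∣ + ∣ q ∣ ≤ ∣ p ∪ q ∣
disjoint-∣p∪q∣ []            []            _ = z≤n
disjoint-∣p∪q∣ (outside ∷ p) (outside ∷ q) d = disjoint-∣p∪q∣ p q (disjoint-tail d)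
disjoint-∣p∪q∣ (outside ∷ p) (inside ∷ q)  d =
  ≤-trans (≤-reflexive (+-suc ∣ p ∣ ∣ q ∣)) (s≤s (disjoint-∣p∪q∣ p q (disjoint-tail d)))
disjoint-∣p∪q∣ (inside ∷ p)  (outside ∷ q) d = s≤s (disjoint-∣p∪q∣ p q (disjoint-tail d))
disjoint-∣p∪q∣ (inside ∷ p)  (inside ∷ q)  d = contradiction here (d here)

subsingleton-∣p∣≤1 : ∀ {n} (p : Subset n) → (∀ {x y} → x ∈ p → y ∈ p → x ≡ y) → ∣ p ∣ ≤ 1
subsingleton-∣p∣≤1 []            _  = z≤n
subsingleton-∣p∣≤1 (outside ∷ p) eq =
  subsingleton-∣p∣≤1 p (λ x∈p y∈p → suc-injective (eq (there x∈p) (there y∈p)))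
subsingleton-∣p∣≤1 {suc n} (inside ∷ p) eq = s≤s (≤-reflexive (trans (cong ∣_∣ p≡⊥) (∣⊥∣≡0 n)))
  where
  p≡⊥ : p ≡ ⊥
  p≡⊥ = Empty-unique (λ { (x , x∈p) → contradiction (eq here (there x∈p)) (λ ()) })

∉∪ : ∀ {n} {p q : Subset n} {x} → x ∉ p → x ∉ q → x ∉ p ∪ q
∉∪ {p = p} {q} x∉p x∉q x∈p∪q = [ x∉p , x∉q ] (x∈p∪q⁻ p q x∈p∪q)

∈-pair⁻ : ∀ {n} {x y z : Fin n} → z ∈ ⁅ x ⁆ ∪ ⁅ y ⁆ → z ≡ x ⊎ z ≡ y
∈-pair⁻ {x = x} {y} z∈ = Sum.map (x∈⁅y⁆⇒x≡y x) (x∈⁅y⁆⇒x≡y y) (x∈p∪q⁻ ⁅ x ⁆ ⁅ y ⁆ z∈)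

2≤∣pair∣ : ∀ {n} {x y : Fin n} → x ≢ y → 2 ≤ ∣ ⁅ x ⁆ ∪ ⁅ y ⁆ ∣
2≤∣pair∣ {x = x} {y} x≢y =
  subst (_≤ ∣ ⁅ x ⁆ ∪ ⁅ y ⁆ ∣) (cong₂ _+_ (∣⁅x⁆∣≡1 x) (∣⁅x⁆∣≡1 y))
        (disjoint-∣p∪q∣ ⁅ x ⁆ ⁅ y ⁆ λ z∈x z∈y → x≢y (trans (sym (x∈⁅y⁆⇒x≡y x z∈x)) (x∈⁅y⁆⇒x≡y y z∈y)))

avoids-three : ∀ {n} (B : Subset n) {a b e : Fin n} → a ≢ b → a ≢ e → b ≢ e →
               a ∉ B → b ∉ B → e ∉ B → ∣ B ∣ ≤ n ∸ 3
avoids-three {n} B {a} {b} {e} a≢b a≢e b≢e a∉B b∉B e∉B =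
  m+n≤o⇒m≤o∸n ∣ B ∣ (begin
    ∣ B ∣ + 3               ≤⟨ +-monoʳ-≤ ∣ B ∣ 3≤∣abe∣ ⟩
    ∣ B ∣ + ∣ abe ∣         ≤⟨ disjoint-∣p∪q∣ B abe B∩abe≡∅ ⟩
    ∣ B ∪ abe ∣             ≤⟨ ∣p∣≤n (B ∪ abe) ⟩
    n                       ∎)
  where
  open ≤-Reasoning
  abe : Subset n
  abe = ⁅ a ⁆ ∪ (⁅ b ⁆ ∪ ⁅ e ⁆)

  3≤∣abe∣ : 3 ≤ ∣ abe ∣
  3≤∣abe∣ = ≤-trans (s≤s (2≤∣pair∣ b≢e)) (subst (_≤ ∣ abe ∣) (cong (_+ _) (∣⁅x⁆∣≡1 a))
              (disjoint-∣p∪q∣ ⁅ a ⁆ _ λ x∈a x∈be →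
                 [ (λ x≡b → a≢b (trans (sym (x∈⁅y⁆⇒x≡y a x∈a)) x≡b))
                 , (λ x≡e → a≢e (trans (sym (x∈⁅y⁆⇒x≡y a x∈a)) x≡e)) ] (∈-pair⁻ x∈be)))

  B∩abe≡∅ : Disjoint B abe
  B∩abe≡∅ x∈B x∈abe with x∈p∪q⁻ ⁅ a ⁆ _ x∈abe
  ... | inj₁ x∈a  = a∉B (subst (_∈ B) (x∈⁅y⁆⇒x≡y a x∈a) x∈B)
  ... | inj₂ x∈be = [ (λ x≡b → b∉B (subst (_∈ B) x≡b x∈B))
                    , (λ x≡e → e∉B (subst (_∈ B) x≡e x∈B)) ] (∈-pair⁻ x∈be)

∈-tabulate⁻ : ∀ {n} {f : Fin n → Bool} {u} → u ∈ tabulate f → f u ≡ true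
∈-tabulate⁻ {f = f} {u} u∈ = trans (sym (lookup∘tabulate f u)) ([]=⇒lookup u∈)

∈-tabulate⁺ : ∀ {n} {f : Fin n → Bool} {u} → f u ≡ true → u ∈ tabulate f
∈-tabulate⁺ {f = f} {u} fu = lookup⇒[]= u (tabulate f) (trans (lookup∘tabulate f u) fu)

anyFin-witness : ∀ {n} (p : Fin n → Bool) → anyFin p ≡ true → ∃ λ w → p w ≡ true
anyFin-witness {suc n} p any with p zero in p0
... | true  = zero , p0
... | false = let w , pw = anyFin-witness (λ i → p (suc i)) any in suc w , pw

anyFin-intro : ∀ {n} (p : Fin n → Bool) w → p w ≡ true → anyFin p ≡ true
anyFin-intro p zero    pw rewrite pw = refl
anyFin-intro p (suc w) pw rewrite anyFin-intro (λ i → p (suc i)) w pw = ∨-zeroʳ (p zero)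

∈-spread⁻ : ∀ {n} {D : Digraph n} {B P u} → u ∈ spread D B P →
            u ∉ P × ∃ λ w → w ∈ B × D w u ≡ true
∈-spread⁻ {D = D} {B} {P} {u} u∈
  with anyFin-witness (λ w → lookup B w ∧ D w u) (∧-conicalʳ _ _ (∈-tabulate⁻ u∈))
... | w , Bw∧Dwu = u∉P , w , lookup⇒[]= w B (∧-conicalˡ _ _ Bw∧Dwu) , ∧-conicalʳ _ _ Bw∧Dwu
  where
  u∉P : u ∉ P
  u∉P u∈P with subst (λ b → not b ≡ true) ([]=⇒lookup u∈P) (∧-conicalˡ _ _ (∈-tabulate⁻ u∈))
  ... | ()

∈-spread⁺ : ∀ {n} {D : Digraph n} {B P u w} → u ∉ P → w ∈ B → D w u ≡ true → u ∈ spread D B P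
∈-spread⁺ {P = P} {u} {w} u∉P w∈B Dwu =
  ∈-tabulate⁺ (cong₂ _∧_ (cong not (¬-not (λ Pu → u∉P (lookup⇒[]= u P Pu))))
                         (anyFin-intro _ w (cong₂ _∧_ ([]=⇒lookup w∈B) Dwu)))

-- The fire process, one round at a time

State : ℕ → Set
State n = Subset n × Subset n

burning protected : ∀ {n} → State n → Subset n
burning   = proj₁
protected = proj₂

step : ∀ {n} → Digraph n → State n → Subset n → State n
step D (B , P) S = B ∪ spread D B (P ∪ S) , P ∪ S

∈-step⁻ : ∀ {n} {D : Digraph n} (s : State n) S {u} → u ∈ burning (step D s S) →
          u ∈ burning s ⊎ (u ∉ protected s ∪ S × ∃ λ w → w ∈ burning s × D w u ≡ true)
∈-step⁻ (B , P) S u∈ = Sum.map₂ ∈-spread⁻ (x∈p∪q⁻ B _ u∈)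

∈-step⁺ : ∀ {n} {D : Digraph n} (s : State n) S {u w} → u ∉ protected s ∪ S →
          w ∈ burning s → D w u ≡ true → u ∈ burning (step D s S)
∈-step⁺ (B , P) S u∉P w∈B Dwu = x∈p∪q⁺ (inj₂ (∈-spread⁺ u∉P w∈B Dwu))

∉-step : ∀ {n} {D : Digraph n} (s : State n) S {u} → u ∉ burning s →
         u ∈ protected s ∪ S ⊎ (∀ {w} → w ∈ burning s → D w u ≡ false) →
         u ∉ burning (step D s S)
∉-step s S u∉B safe u∈B′ with ∈-step⁻ s S u∈B′ | safe
... | inj₁ u∈B                  | _            = u∉B u∈B
... | inj₂ (u∉P∪S , _)          | inj₁ u∈P∪S   = u∉P∪S u∈P∪S
... | inj₂ (_ , _ , w∈B , Dwu)  | inj₂ no-arcs = contradiction (trans (sym Dwu) (no-arcs w∈B)) λ ()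

Legal : ∀ {n} → ℕ → State n → Subset n → Set
Legal f s S = ∣ S ∣ ≤ f × S ⊆ ∁ (burning s ∪ protected s)

⊥-legal : ∀ {n} f (s : State n) → Legal f s ⊥
⊥-legal {n} f s = subst (_≤ f) (sym (∣⊥∣≡0 n)) z≤n , ⊥⊆

⁅⁆-legal : ∀ {n} (s : State n) {x} → x ∉ burning s → x ∉ protected s → Legal 1 s ⁅ x ⁆
⁅⁆-legal s {x} x∉B x∉P = ≤-reflexive (∣⁅x⁆∣≡1 x) , λ y∈⁅x⁆ →
  subst (_∈ ∁ _) (sym (x∈⁅y⁆⇒x≡y x y∈⁅x⁆)) (x∉p⇒x∈∁p (∉∪ x∉B x∉P))

run-invariant : ∀ {n} (D : Digraph n) v σ (I : State n → Set) →
                (∀ s S → I s → I (step D s S)) →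
                ∀ {k l} → k ≤ l → I (run D v σ k) → I (run D v σ l)
run-invariant D v σ I preserved {k} {l} k≤l Iₖ =
  subst (λ t → I (run D v σ t)) (m∸n+n≡m k≤l) (later (l ∸ k))
  where
  later : ∀ j → I (run D v σ (j + k))
  later zero    = Iₖ
  later (suc j) = preserved _ (σ (j + k)) (later j)

burning-mono : ∀ {n} (D : Digraph n) v σ {k l} → k ≤ l →
               burning (run D v σ k) ⊆ burning (run D v σ l)
burning-mono D v σ k≤l {x} =
  run-invariant D v σ (λ s → x ∈ burning s) (λ s S → p⊆p∪q _) k≤l

-- Optimal strategies exist

subsets : ∀ n → List (Subset n)
subsets zero    = [] ∷ []
subsets (suc n) = map (outside ∷_) (subsets n) ++ map (inside ∷_) (subsets n)

∈-subsets : ∀ {n} (p : Subset n) → p ∈ₗ subsets n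
∈-subsets []            = Any.here refl
∈-subsets (outside ∷ p) = ∈-++⁺ˡ (∈-map⁺ (outside ∷_) (∈-subsets p))
∈-subsets (inside ∷ p)  = ∈-++⁺ʳ (map (outside ∷_) (subsets _)) (∈-map⁺ (inside ∷_) (∈-subsets p))

-- Backward induction: since only finitely many moves are legal in each state,
-- the best achievable outcome with r rounds left is computable, and greedily
-- playing a best move achieves the minimum over all valid strategies.
module Optimal {n} (D : Digraph n) (f : ℕ) where

  legalMove? : (s : State n) → Decidable (Legal f s)
  legalMove? s S = (∣ S ∣ ≤? f) ×-dec (S ⊆? ∁ (burning s ∪ protected s))

  legalMoves : State n → List (Subset n)
  legalMoves s = filter (legalMove? s) (subsets n)

  mutual
    -- The least number of burning vertices reachable after r more rounds.
    value : ℕ → State n → ℕ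
    value zero    s = ∣ burning s ∣
    value (suc r) s = value r (step D s (bestMove r s))

    bestMove : ℕ → State n → Subset n
    bestMove r s = argmin (λ S → value r (step D s S)) ⊥ (legalMoves s)

  bestMove-legal : ∀ r s → Legal f s (bestMove r s)
  bestMove-legal r s =
    argmin-all (λ S → value r (step D s S)) (⊥-legal {n} f s) (all-filter (legalMove? s) (subsets n))

  bestMove-optimal : ∀ r s S → Legal f s S →
                     value r (step D s (bestMove r s)) ≤ value r (step D s S)
  bestMove-optimal r s S legal =
    All.lookup (f[argmin]≤f[xs] ⊥ (legalMoves s)) (∈-filter⁺ (legalMove? s) (∈-subsets S) legal)

  value-≤ : ∀ v σ → Valid D f v σ → ∀ r j →
            value r (run D v σ j) ≤ ∣ burning (run D v σ (r + j)) ∣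
  value-≤ v σ valid zero    j = ≤-refl
  value-≤ v σ valid (suc r) j =
    ≤-trans (bestMove-optimal r (run D v σ j) (σ j) (valid j))
            (subst (λ t → value r (run D v σ (suc j)) ≤ ∣ burning (run D v σ t) ∣)
                   (+-suc r j) (value-≤ v σ valid r (suc j)))

  module Greedy (v : Fin n) where
    greedyState : ℕ → State n
    greedyState zero    = ⁅ v ⁆ , ⊥
    greedyState (suc j) = step D (greedyState j) (bestMove (n ∸ suc j) (greedyState j))

    greedy : Strategy n
    greedy j = bestMove (n ∸ suc j) (greedyState j)

    run-greedy : ∀ j → run D v greedy j ≡ greedyState j
    run-greedy zero    = refl
    run-greedy (suc j) = cong (λ s → step D s (greedy j)) (run-greedy j)

    greedy-valid : Valid D f v greedy
    greedy-valid j = subst (λ s → Legal f s (greedy j)) (sym (run-greedy j))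
                           (bestMove-legal (n ∸ suc j) (greedyState j))

    greedy-attains : ∀ r j → r + j ≡ n → value r (greedyState j) ≡ ∣ burning (greedyState n) ∣
    greedy-attains zero    j refl  = refl
    greedy-attains (suc r) j r+j≡n = begin
      value r (step D (greedyState j) (bestMove r (greedyState j)))
        ≡⟨ cong (λ t → value r (step D (greedyState j) (bestMove t (greedyState j)))) (sym rounds-left) ⟩
      value r (greedyState (suc j))
        ≡⟨ greedy-attains r (suc j) (trans (+-suc r j) r+j≡n) ⟩
      ∣ burning (greedyState n) ∣ ∎
      where
      open ≡-Reasoning
      rounds-left : n ∸ suc j ≡ r
      rounds-left = trans (cong (_∸ suc j) (trans (sym r+j≡n) (sym (+-suc r j)))) (m+n∸n≡m r (suc j))

  minBurnt-exists : ∀ v → Σ ℕ (IsMinBurnt D f v)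
  minBurnt-exists v = value n (⁅ v ⁆ , ⊥) , (greedy , greedy-valid , greedy-burnt) , optimal
    where
    open Greedy v
    greedy-burnt : burnt D v greedy ≡ value n (⁅ v ⁆ , ⊥)
    greedy-burnt = trans (cong (λ s → ∣ burning s ∣) (run-greedy n))
                         (sym (greedy-attains n 0 (+-identityʳ n)))
    optimal : ∀ σ → Valid D f v σ → value n (⁅ v ⁆ , ⊥) ≤ burnt D v σ
    optimal σ valid = subst (λ t → value n (⁅ v ⁆ , ⊥) ≤ ∣ burning (run D v σ t) ∣)
                            (+-identityʳ n) (value-≤ v σ valid n 0)

-- Determining β and β⃗ from matching upper and lower bounds

record Containable {n} (D : Digraph n) (f : ℕ) (v : Fin n) (b : ℕ) : Set where
  constructor contained-by
  field
    strategy : Strategy n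
    valid    : Valid D f v strategy
    bound    : burnt D v strategy ≤ b

Unstoppable : ∀ {n} → Digraph n → ℕ → Fin n → ℕ → Set
Unstoppable D f v b = ∀ σ → Valid D f v σ → b ≤ burnt D v σ

isBeta-from-bounds : ∀ {n} {D : Digraph n} {f b} →
                     (∀ v → Containable D f v b) → Σ (Fin n) (λ v → Unstoppable D f v b) →
                     IsBeta D f b
isBeta-from-bounds {D = D} {f} {b} contain (v , unstoppable) with contain v
... | contained-by σ valid burnt≤b =
  (v , (σ , valid , ≤-antisym burnt≤b (unstoppable σ valid)) , unstoppable) , maximal
  where
  maximal : ∀ w m → IsMinBurnt D f w m → m ≤ b
  maximal w m (_ , m-min) with contain w
  ... | contained-by τ τ-valid τ≤b = ≤-trans (m-min τ τ-valid) τ≤b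

-- A fire burning at least b vertices forces β(D, f) ≥ b.  This needs the
-- minimum at that vertex to exist, which is where optimal strategies come in.
β-≥ : ∀ {n} {D : Digraph n} {f b b′} →
      Σ (Fin n) (λ v → Unstoppable D f v b) → IsBeta D f b′ → b ≤ b′
β-≥ {D = D} {f} (v , unstoppable) (_ , maximal) with Optimal.minBurnt-exists D f v
... | m , min@((σ , valid , burnt≡m) , _) =
  ≤-trans (subst (_ ≤_) burnt≡m (unstoppable σ valid)) (maximal v m min)

orientedBeta-from-bounds : ∀ {n} {G : Graph n} {f b} (E : Digraph n) → IsOrientation G E →
                           (∀ v → Containable E f v b) →
                           (∀ D → IsOrientation G D → Σ (Fin n) (λ v → Unstoppable D f v b)) →
                           IsOrientedBeta G f b
orientedBeta-from-bounds E E-orients contain unstoppable =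
  (E , E-orients , isBeta-from-bounds contain (unstoppable E E-orients)) ,
  λ D b′ D-orients β≡b′ → β-≥ (unstoppable D D-orients) β≡b′

-- Tournaments

record IsTournament {A : Set} (R : A → A → Bool) : Set where
  field
    loopless : ∀ x → R x x ≡ false
    one-way  : ∀ x y → x ≢ y → (R x y xor R y x) ≡ true

  reverse : ∀ {x y} → x ≢ y → R x y ≡ false → R y x ≡ true
  reverse {x} {y} x≢y Rxy≡false = subst (λ b → (b xor R y x) ≡ true) Rxy≡false (one-way x y x≢y)

open IsTournament

adj-K : ∀ {n} {i j : Fin n} → i ≢ j → adj (K n) i j ≡ true
adj-K {i = i} {j} i≢j with i ≟ j
... | yes i≡j = contradiction i≡j i≢j
... | no  _   = refl

orientation⇒tournament : ∀ {n} {D : Digraph n} → IsOrientation (K n) D → IsTournament D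
orientation⇒tournament {n} {D} orients = record
  { loopless = λ x → ¬-not (no-loop x)
  ; one-way  = λ x y x≢y → proj₂ (orients x y) (adj-K x≢y)
  }
  where
  no-loop : ∀ x → D x x ≢ true
  no-loop x Dxx = contradiction (trans (sym (proj₁ (orients x x) Dxx)) (irrefl (K n) x)) λ ()

tournament⇒orientation : ∀ {n} {D : Digraph n} → IsTournament D → IsOrientation (K n) D
tournament⇒orientation T i j with i ≟ j
... | yes refl = (λ Dii → contradiction (trans (sym (loopless T i)) Dii) λ ()) , λ ()
... | no  i≢j  = (λ _ → refl) , λ _ → one-way T i j i≢j

pullback-tournament : ∀ {A B : Set} {R : B → B → Bool} (h : A → B) →
                      (∀ {x y} → h x ≡ h y → x ≡ y) → IsTournament R →
                      IsTournament (λ x y → R (h x) (h y))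
pullback-tournament h injective T = record
  { loopless = λ x → loopless T (h x)
  ; one-way  = λ x y x≢y → one-way T (h x) (h y) (λ hx≡hy → x≢y (injective hx≡hy))
  }

_⊕_ : ∀ {A B : Set} → (A → A → Bool) → (B → B → Bool) → (A ⊎ B → A ⊎ B → Bool)
(R ⊕ S) (inj₁ x) (inj₁ y) = R x y
(R ⊕ S) (inj₁ _) (inj₂ _) = true
(R ⊕ S) (inj₂ _) (inj₁ _) = false
(R ⊕ S) (inj₂ x) (inj₂ y) = S x y

⊕-tournament : ∀ {A B : Set} {R : A → A → Bool} {S : B → B → Bool} →
               IsTournament R → IsTournament S → IsTournament (R ⊕ S)
⊕-tournament {R = R} {S} TR TS = record { loopless = no-loops ; one-way = one-arc }
  where
  no-loops : ∀ x → (R ⊕ S) x x ≡ false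
  no-loops (inj₁ x) = loopless TR x
  no-loops (inj₂ x) = loopless TS x
  one-arc : ∀ x y → x ≢ y → ((R ⊕ S) x y xor (R ⊕ S) y x) ≡ true
  one-arc (inj₁ x) (inj₁ y) x≢y = one-way TR x y (λ x≡y → x≢y (cong inj₁ x≡y))
  one-arc (inj₁ x) (inj₂ y) _   = refl
  one-arc (inj₂ x) (inj₁ y) _   = refl
  one-arc (inj₂ x) (inj₂ y) x≢y = one-way TS x y (λ x≡y → x≢y (cong inj₂ x≡y))

transitive : ∀ {m} → Fin m → Fin m → Bool
transitive k l = does (k <? l)

transitive-tournament : ∀ {m} → IsTournament (transitive {m})
transitive-tournament = record { loopless = λ k → dec-false (k <? k) (<-irrefl refl) ; one-way = one-arc }
  where
  one-arc : ∀ {m} (k l : Fin m) → k ≢ l → (does (k <? l) xor does (l <? k)) ≡ true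
  one-arc k l k≢l with <-cmp k l
  ... | tri< k<l _ l≮k rewrite dec-true (k <? l) k<l | dec-false (l <? k) l≮k = refl
  ... | tri≈ _ k≡l _   = contradiction k≡l k≢l
  ... | tri> k≮l _ l<k rewrite dec-false (k <? l) k≮l | dec-true (l <? k) l<k = refl

-- The lower bound: in a tournament, a fire at a vertex of maximum out-degree
-- burns at least n ∸ 3 vertices when one vertex is protected per round.

outNbrs : ∀ {n} → Digraph n → Fin n → Subset n
outNbrs D v = tabulate (D v)

∈-outNbrs⁻ : ∀ {n} {D : Digraph n} {v u} → u ∈ outNbrs D v → D v u ≡ true
∈-outNbrs⁻ {D = D} {v} = ∈-tabulate⁻ {f = D v}

∈-outNbrs⁺ : ∀ {n} {D : Digraph n} {v u} → D v u ≡ true → u ∈ outNbrs D v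
∈-outNbrs⁺ {D = D} {v} = ∈-tabulate⁺ {f = D v}

outdeg : ∀ {n} → Digraph n → Fin n → ℕ
outdeg D v = ∣ outNbrs D v ∣

maximiser : ∀ {n} (g : Fin n → ℕ) → Fin n → Σ (Fin n) λ v → ∀ y → g y ≤ g v
maximiser {n} g d = argmax g d (allFin n) , λ y → All.lookup (f[xs]≤f[argmax] d (allFin n)) (∈-allFin y)

-- After two rounds the only vertices that are neither burning nor protected
-- ("spared") beat v and every out-neighbour of v not protected in round one;
-- so an arc between two spared vertices would give one of them a larger
-- out-degree than v.  Hence at most one vertex is spared, at most two are
-- protected, and at least n ∸ 3 are burning.
module FireAtMaxOutdegree {n} {D : Digraph n} (T : IsTournament D) {v : Fin n}
       (v-max : ∀ y → outdeg D y ≤ outdeg D v) {σ : Strategy n} (valid : Valid D 1 v σ) where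

  B₁ B₂ P₁ P₂ : Subset n
  B₁ = burning (run D v σ 1)
  B₂ = burning (run D v σ 2)
  P₁ = protected (run D v σ 1)
  P₂ = protected (run D v σ 2)

  Spared : Subset n
  Spared = ∁ (B₂ ∪ P₂)

  C : Subset n
  C = outNbrs D v ∩ ∁ (σ 0)

  v∈B₁ : v ∈ B₁
  v∈B₁ = x∈p∪q⁺ (inj₁ (x∈⁅x⁆ v))

  C⊆B₁ : ∀ {u} → u ∈ C → u ∈ B₁
  C⊆B₁ {u} u∈C with x∈p∩q⁻ (outNbrs D v) (∁ (σ 0)) u∈C
  ... | u∈N[v] , u∈∁σ₀ = ∈-step⁺ (⁅ v ⁆ , ⊥) (σ 0) u∉P₁ (x∈⁅x⁆ v) (∈-outNbrs⁻ {D = D} u∈N[v])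
    where
    u∉P₁ : u ∉ P₁
    u∉P₁ = ∉∪ ∉⊥ (x∈∁p⇒x∉p u∈∁σ₀)

  module Spared {y : Fin n} (y-spared : y ∈ Spared) where
    y∉B₂ : y ∉ B₂
    y∉B₂ y∈B₂ = x∈∁p⇒x∉p y-spared (x∈p∪q⁺ (inj₁ y∈B₂))

    y∉P₂ : y ∉ P₂
    y∉P₂ y∈P₂ = x∈∁p⇒x∉p y-spared (x∈p∪q⁺ (inj₂ y∈P₂))

    y∉B₁ : y ∉ B₁
    y∉B₁ y∈B₁ = y∉B₂ (p⊆p∪q _ y∈B₁)

    v≢y : v ≢ y
    v≢y v≡y = y∉B₁ (subst (_∈ B₁) v≡y v∈B₁)

    -- v does not beat y, or y would have caught fire in round one.
    v↛y : D v y ≡ false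
    v↛y = ¬-not λ Dvy → y∉B₁ (∈-step⁺ (⁅ v ⁆ , ⊥) (σ 0) (λ y∈P₁ → y∉P₂ (p⊆p∪q _ y∈P₁)) (x∈⁅x⁆ v) Dvy)

    y→v : D y v ≡ true
    y→v = reverse T v≢y v↛y

    -- y beats every vertex of C, or y would have caught fire in round two.
    y→C : ∀ {u} → u ∈ C → D y u ≡ true
    y→C {u} u∈C = reverse T u≢y u↛y
      where
      u≢y : u ≢ y
      u≢y u≡y = y∉B₁ (subst (_∈ B₁) u≡y (C⊆B₁ u∈C))
      u↛y : D u y ≡ false
      u↛y = ¬-not λ Duy → y∉B₂ (∈-step⁺ (run D v σ 1) (σ 1) y∉P₂ (C⊆B₁ u∈C) Duy)

  -- Protecting one vertex in round one costs v at most one burning out-neighbour.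
  outdeg-v≤ : outdeg D v ≤ ∣ C ∣ + 1
  outdeg-v≤ = begin
    outdeg D v         ≤⟨ p⊆q⇒∣p∣≤∣q∣ N[v]⊆C∪σ₀ ⟩
    ∣ C ∪ σ 0 ∣        ≤⟨ ∣p∪q∣≤∣p∣+∣q∣ C (σ 0) ⟩
    ∣ C ∣ + ∣ σ 0 ∣    ≤⟨ +-monoʳ-≤ ∣ C ∣ (proj₁ (valid 0)) ⟩
    ∣ C ∣ + 1          ∎
    where
    open ≤-Reasoning
    N[v]⊆C∪σ₀ : outNbrs D v ⊆ C ∪ σ 0
    N[v]⊆C∪σ₀ {u} u∈N[v] with u ∈? σ 0
    ... | yes u∈σ₀ = x∈p∪q⁺ (inj₂ u∈σ₀)
    ... | no  u∉σ₀ = x∈p∪q⁺ (inj₁ (x∈p∩q⁺ (u∈N[v] , x∉p⇒x∈∁p u∉σ₀)))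

  spared-independent : ∀ {y y′} → y ∈ Spared → y′ ∈ Spared → y ≢ y′ → D y y′ ≡ false
  spared-independent {y} {y′} y-spared y′-spared y≢y′ = ¬-not λ Dyy′ → 1+n≰n (begin-strict
    ∣ C ∣ + 1              <⟨ +-monoʳ-< ∣ C ∣ ≤-refl ⟩
    ∣ C ∣ + 2              ≤⟨ +-monoʳ-≤ ∣ C ∣ (2≤∣pair∣ v≢y′) ⟩
    ∣ C ∣ + ∣ vy′ ∣        ≤⟨ disjoint-∣p∪q∣ C vy′ C∩vy′≡∅ ⟩
    ∣ C ∪ vy′ ∣            ≤⟨ p⊆q⇒∣p∣≤∣q∣ (C∪vy′⊆N[y] Dyy′) ⟩
    outdeg D y             ≤⟨ v-max y ⟩
    outdeg D v             ≤⟨ outdeg-v≤ ⟩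
    ∣ C ∣ + 1              ∎)
    where
    open ≤-Reasoning
    module Y  = Spared y-spared
    module Y′ = Spared y′-spared
    vy′ : Subset n
    vy′ = ⁅ v ⁆ ∪ ⁅ y′ ⁆
    v≢y′ : v ≢ y′
    v≢y′ = Y′.v≢y
    C∩vy′≡∅ : Disjoint C vy′
    C∩vy′≡∅ {u} u∈C u∈vy′
      with ∈-outNbrs⁻ {D = D} (proj₁ (x∈p∩q⁻ (outNbrs D v) (∁ (σ 0)) u∈C)) | ∈-pair⁻ u∈vy′
    ... | Dvu | inj₁ refl = not-¬ (loopless T v) Dvu
    ... | Dvu | inj₂ refl = not-¬ Y′.v↛y Dvu
    C∪vy′⊆N[y] : D y y′ ≡ true → C ∪ vy′ ⊆ outNbrs D y
    C∪vy′⊆N[y] Dyy′ u∈ with x∈p∪q⁻ C vy′ u∈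
    ... | inj₁ u∈C = ∈-outNbrs⁺ {D = D} (Y.y→C u∈C)
    ... | inj₂ u∈vy′ = [ (λ { refl → ∈-outNbrs⁺ {D = D} Y.y→v }) , (λ { refl → ∈-outNbrs⁺ {D = D} Dyy′ }) ]
                         (∈-pair⁻ u∈vy′)

  ∣Spared∣≤1 : ∣ Spared ∣ ≤ 1
  ∣Spared∣≤1 = subsingleton-∣p∣≤1 Spared same
    where
    same : ∀ {y y′} → y ∈ Spared → y′ ∈ Spared → y ≡ y′
    same {y} {y′} y-spared y′-spared with y ≟ y′
    ... | yes y≡y′ = y≡y′
    ... | no  y≢y′ = contradiction (reverse T y≢y′ (spared-independent y-spared y′-spared y≢y′))
                                   (not-¬ (spared-independent y′-spared y-spared (y≢y′ ∘ sym)))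

  ∣P₂∣≤2 : ∣ P₂ ∣ ≤ 2
  ∣P₂∣≤2 = begin
    ∣ P₁ ∪ σ 1 ∣                 ≤⟨ ∣p∪q∣≤∣p∣+∣q∣ P₁ (σ 1) ⟩
    ∣ ⊥ ∪ σ 0 ∣ + ∣ σ 1 ∣        ≤⟨ +-mono-≤ (∣p∪q∣≤∣p∣+∣q∣ ⊥ (σ 0)) (proj₁ (valid 1)) ⟩
    ∣ ⊥ {n} ∣ + ∣ σ 0 ∣ + 1      ≡⟨ cong (λ k → k + ∣ σ 0 ∣ + 1) (∣⊥∣≡0 n) ⟩
    ∣ σ 0 ∣ + 1                  ≤⟨ +-monoˡ-≤ 1 (proj₁ (valid 0)) ⟩
    2                            ∎
    where open ≤-Reasoning

  -- Every vertex is burning, protected or spared after two rounds.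
  n≤3+∣B₂∣ : n ≤ 3 + ∣ B₂ ∣
  n≤3+∣B₂∣ = begin
    n                              ≡⟨ sym (trans (cong ∣_∣ (p∪∁p≡⊤ (B₂ ∪ P₂))) (∣⊤∣≡n n)) ⟩
    ∣ (B₂ ∪ P₂) ∪ Spared ∣         ≤⟨ ∣p∪q∣≤∣p∣+∣q∣ (B₂ ∪ P₂) Spared ⟩
    ∣ B₂ ∪ P₂ ∣ + ∣ Spared ∣       ≤⟨ +-mono-≤ (∣p∪q∣≤∣p∣+∣q∣ B₂ P₂) ∣Spared∣≤1 ⟩
    ∣ B₂ ∣ + ∣ P₂ ∣ + 1            ≤⟨ +-monoˡ-≤ 1 (+-monoʳ-≤ ∣ B₂ ∣ ∣P₂∣≤2) ⟩
    ∣ B₂ ∣ + 2 + 1                 ≡⟨ +-comm (∣ B₂ ∣ + 2) 1 ⟩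
    1 + (∣ B₂ ∣ + 2)               ≡⟨ cong suc (+-comm ∣ B₂ ∣ 2) ⟩
    3 + ∣ B₂ ∣                     ∎
    where open ≤-Reasoning

  burns-n∸3 : 2 ≤ n → n ∸ 3 ≤ burnt D v σ
  burns-n∸3 2≤n = ≤-trans (m≤n+o⇒m∸n≤o n 3 n≤3+∣B₂∣) (p⊆q⇒∣p∣≤∣q∣ B₂⊆Bₙ)
    where
    B₂⊆Bₙ : B₂ ⊆ burning (run D v σ n)
    B₂⊆Bₙ = burning-mono D v σ 2≤n

tournament-unstoppable : ∀ {n} {D : Digraph n} → IsTournament D → 2 ≤ n →
                         Σ (Fin n) λ v → Unstoppable D 1 v (n ∸ 3)
tournament-unstoppable {n} {D} T 2≤n with maximiser (outdeg D) (fromℕ< {0} (≤-trans (s≤s z≤n) 2≤n))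
... | v , v-max = v , λ σ valid → FireAtMaxOutdegree.burns-n∸3 {D = D} T {v} v-max {σ} valid 2≤n

-- Containing a fire: sealing it inside a set of vertices

Sealed : ∀ {n} → Digraph n → Subset n → State n → Set
Sealed D G s = burning s ⊆ G × (∀ {w u} → w ∈ G → u ∉ G → D w u ≡ true → u ∈ protected s)

sealed-step : ∀ {n} {D : Digraph n} {G} s S → Sealed D G s → Sealed D G (step D s S)
sealed-step {D = D} {G} s S (B⊆G , exits-protected) =
  B′⊆G , λ w∈G u∉G Dwu → p⊆p∪q S (exits-protected w∈G u∉G Dwu)
  where
  B′⊆G : burning (step D s S) ⊆ G
  B′⊆G {u} u∈B′ with ∈-step⁻ s S u∈B′
  ... | inj₁ u∈B = B⊆G u∈B
  ... | inj₂ (u∉P∪S , w , w∈B , Dwu) with u ∈? G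
  ...   | yes u∈G = u∈G
  ...   | no  u∉G = contradiction (p⊆p∪q S (exits-protected (B⊆G w∈B) u∉G Dwu)) u∉P∪S

sealed-burnt≤ : ∀ {n} {D : Digraph n} {v σ G k} → Sealed D G (run D v σ k) → k ≤ n →
                ∀ {a b e} → a ≢ b → a ≢ e → b ≢ e → a ∉ G → b ∉ G → e ∉ G →
                burnt D v σ ≤ n ∸ 3
sealed-burnt≤ {n} {D} {v} {σ} {G} sealed k≤n a≢b a≢e b≢e a∉G b∉G e∉G =
  avoids-three _ a≢b a≢e b≢e (a∉G ∘ Bₙ⊆G) (b∉G ∘ Bₙ⊆G) (e∉G ∘ Bₙ⊆G)
  where
  Bₙ⊆G : burning (run D v σ n) ⊆ G
  Bₙ⊆G = proj₁ (run-invariant D v σ (Sealed D G) sealed-step k≤n sealed)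

closed-contains : ∀ {n} {D : Digraph n} {f} (G : Subset n) →
                  (∀ {w u} → w ∈ G → D w u ≡ true → u ∈ G) →
                  ∀ {v a b e} → v ∈ G → a ≢ b → a ≢ e → b ≢ e → a ∉ G → b ∉ G → e ∉ G →
                  Containable D f v (n ∸ 3)
closed-contains {D = D} {f} G closed {v} v∈G a≢b a≢e b≢e a∉G b∉G e∉G =
  contained-by (λ _ → ⊥) (λ k → ⊥-legal f (run D v (λ _ → ⊥) k))
    (sealed-burnt≤ sealed₀ z≤n a≢b a≢e b≢e a∉G b∉G e∉G)
  where
  sealed₀ : Sealed D G (⁅ v ⁆ , ⊥)
  sealed₀ = (λ u∈⁅v⁆ → subst (_∈ G) (sym (x∈⁅y⁆⇒x≡y v u∈⁅v⁆)) v∈G) ,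
            λ w∈G u∉G Dwu → contradiction (closed w∈G Dwu) u∉G

-- A rescue configuration at c: protecting a and then b contains a fire
-- starting at c, since c reaches neither b nor e directly and the only
-- in-neighbours of e are a and b.
record Rescue {n} (D : Digraph n) (c a b e : Fin n) : Set where
  field
    c≢a    : c ≢ a
    c≢b    : c ≢ b
    c≢e    : c ≢ e
    a≢b    : a ≢ b
    a≢e    : a ≢ e
    b≢e    : b ≢ e
    c↛b    : D c b ≡ false
    c↛e    : D c e ≡ false
    into-e : ∀ w → D w e ≡ true → w ≡ a ⊎ w ≡ b

rescue-contains : ∀ {n} {D : Digraph n} {c a b e} → Rescue D c a b e → 2 ≤ n →
                  Containable D 1 c (n ∸ 3)
rescue-contains {n} {D} {c} {a} {b} {e} R 2≤n =
  contained-by σ valid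
    (sealed-burnt≤ sealed₂ 2≤n a≢b a≢e b≢e (x∈p⇒x∉∁p a∈abe) (x∈p⇒x∉∁p b∈abe) (x∈p⇒x∉∁p e∈abe))
  where
  open Rescue R

  σ : Strategy n
  σ 0             = ⁅ a ⁆
  σ 1             = ⁅ b ⁆
  σ (suc (suc _)) = ⊥

  B₁ P₁ B₂ P₂ abe : Subset n
  B₁  = burning (run D c σ 1)
  P₁  = protected (run D c σ 1)
  B₂  = burning (run D c σ 2)
  P₂  = protected (run D c σ 2)
  abe = ⁅ a ⁆ ∪ (⁅ b ⁆ ∪ ⁅ e ⁆)

  ∈abe⁻ : ∀ {x} → x ∈ abe → x ≡ a ⊎ x ≡ b ⊎ x ≡ e
  ∈abe⁻ x∈abe = Sum.map (x∈⁅y⁆⇒x≡y a) ∈-pair⁻ (x∈p∪q⁻ ⁅ a ⁆ _ x∈abe)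

  a∈abe : a ∈ abe
  a∈abe = x∈p∪q⁺ (inj₁ (x∈⁅x⁆ a))
  b∈abe : b ∈ abe
  b∈abe = x∈p∪q⁺ (inj₂ (x∈p∪q⁺ (inj₁ (x∈⁅x⁆ b))))
  e∈abe : e ∈ abe
  e∈abe = x∈p∪q⁺ (inj₂ (x∈p∪q⁺ (inj₂ (x∈⁅x⁆ e))))

  not-c : ∀ {x} → c ≢ x → x ∉ ⁅ c ⁆
  not-c c≢x x∈⁅c⁆ = c≢x (sym (x∈⁅y⁆⇒x≡y c x∈⁅c⁆))

  c-misses : ∀ {x} → D c x ≡ false → ∀ {w} → w ∈ ⁅ c ⁆ → D w x ≡ false
  c-misses {x} c↛x w∈⁅c⁆ = subst (λ w → D w x ≡ false) (sym (x∈⁅y⁆⇒x≡y c w∈⁅c⁆)) c↛x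

  a∈P₁ : a ∈ P₁
  a∈P₁ = x∈p∪q⁺ (inj₂ (x∈⁅x⁆ a))
  a∈P₂ : a ∈ P₂
  a∈P₂ = p⊆p∪q _ a∈P₁
  b∈P₂ : b ∈ P₂
  b∈P₂ = x∈p∪q⁺ (inj₂ (x∈⁅x⁆ b))

  -- Round one: a is protected, and c reaches neither b nor e.
  a∉B₁ : a ∉ B₁
  a∉B₁ = ∉-step (⁅ c ⁆ , ⊥) (σ 0) (not-c c≢a) (inj₁ a∈P₁)
  b∉B₁ : b ∉ B₁
  b∉B₁ = ∉-step (⁅ c ⁆ , ⊥) (σ 0) (not-c c≢b) (inj₂ (c-misses c↛b))
  e∉B₁ : e ∉ B₁
  e∉B₁ = ∉-step (⁅ c ⁆ , ⊥) (σ 0) (not-c c≢e) (inj₂ (c-misses c↛e))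

  -- Round two: a and b are protected, and neither in-neighbour of e burns.
  a∉B₂ : a ∉ B₂
  a∉B₂ = ∉-step (run D c σ 1) (σ 1) a∉B₁ (inj₁ a∈P₂)
  b∉B₂ : b ∉ B₂
  b∉B₂ = ∉-step (run D c σ 1) (σ 1) b∉B₁ (inj₁ b∈P₂)
  e∉B₂ : e ∉ B₂
  e∉B₂ = ∉-step (run D c σ 1) (σ 1) e∉B₁ (inj₂ λ {w} w∈B₁ → ¬-not λ Dwe →
           [ (λ { refl → a∉B₁ w∈B₁ }) , (λ { refl → b∉B₁ w∈B₁ }) ] (into-e w Dwe))

  sealed₂ : Sealed D (∁ abe) (run D c σ 2)
  sealed₂ = B₂⊆G , exits-protected
    where
    B₂⊆G : B₂ ⊆ ∁ abe
    B₂⊆G {u} u∈B₂ = x∉p⇒x∈∁p λ u∈abe →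
      [ (λ { refl → a∉B₂ u∈B₂ }) , [ (λ { refl → b∉B₂ u∈B₂ }) , (λ { refl → e∉B₂ u∈B₂ }) ] ] (∈abe⁻ u∈abe)
    exits-protected : ∀ {w u} → w ∈ ∁ abe → u ∉ ∁ abe → D w u ≡ true → u ∈ P₂
    exits-protected {w} w∈G u∉G Dwu with ∈abe⁻ (x∉∁p⇒x∈p u∉G)
    ... | inj₁ refl        = a∈P₂
    ... | inj₂ (inj₁ refl) = b∈P₂
    ... | inj₂ (inj₂ refl) =
      contradiction ([ (λ { refl → a∈abe }) , (λ { refl → b∈abe }) ] (into-e w Dwu)) (x∈∁p⇒x∉p w∈G)

  valid : Valid D 1 c σ
  valid 0             = ⁅⁆-legal (⁅ c ⁆ , ⊥) (not-c c≢a) ∉⊥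
  valid 1             = ⁅⁆-legal (run D c σ 1) b∉B₁ (∉∪ ∉⊥ λ b∈⁅a⁆ → a≢b (sym (x∈⁅y⁆⇒x≡y a b∈⁅a⁆)))
  valid (suc (suc k)) = ⊥-legal 1 (run D c σ (suc (suc k)))

-- The extremal orientation

by-evaluation : ∀ {k} {P : Fin k → Set} (P? : Decidable P) → {True (all? P?)} → ∀ x → P x
by-evaluation P? {ok} = toWitness ok

next : Fin 5 → Fin 5
next zero                         = suc zero
next (suc zero)                   = suc (suc zero)
next (suc (suc zero))             = suc (suc (suc zero))
next (suc (suc (suc zero)))       = suc (suc (suc (suc zero)))
next (suc (suc (suc (suc zero)))) = zero

shift : ℕ → Fin 5 → Fin 5
shift zero    x = x
shift (suc k) x = next (shift k x)

C₅ : Digraph 5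
C₅ x y = does (y ≟ shift 1 x) ∨ does (y ≟ shift 2 x)

C₅-tournament : IsTournament C₅
C₅-tournament = record
  { loopless = by-evaluation (λ x → C₅ x x ≟ᵇ false)
  ; one-way  = by-evaluation (λ x → all? λ y → ¬? (x ≟ y) →-dec ((C₅ x y xor C₅ y x) ≟ᵇ true))
  }

C₅-rescue : ∀ x → Rescue C₅ x (shift 2 x) (shift 3 x) (shift 4 x)
C₅-rescue x = record
  { c≢a    = by-evaluation (λ z → ¬? (z ≟ shift 2 z)) x
  ; c≢b    = by-evaluation (λ z → ¬? (z ≟ shift 3 z)) x
  ; c≢e    = by-evaluation (λ z → ¬? (z ≟ shift 4 z)) x
  ; a≢b    = by-evaluation (λ z → ¬? (shift 2 z ≟ shift 3 z)) x
  ; a≢e    = by-evaluation (λ z → ¬? (shift 2 z ≟ shift 4 z)) x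
  ; b≢e    = by-evaluation (λ z → ¬? (shift 3 z ≟ shift 4 z)) x
  ; c↛b    = by-evaluation (λ z → C₅ z (shift 3 z) ≟ᵇ false) x
  ; c↛e    = by-evaluation (λ z → C₅ z (shift 4 z) ≟ᵇ false) x
  ; into-e = by-evaluation (λ z → all? λ w → (C₅ w (shift 4 z) ≟ᵇ true)
                                      →-dec ((w ≟ shift 2 z) ⊎-dec (w ≟ shift 3 z))) x
  }

Tₘ : ∀ m → Digraph (5 + m)
Tₘ m i j = (C₅ ⊕ transitive) (splitAt 5 i) (splitAt 5 j)

Tₘ-tournament : ∀ m → IsTournament (Tₘ m)
Tₘ-tournament m = pullback-tournament (splitAt 5) splitAt-injective
                    (⊕-tournament C₅-tournament transitive-tournament)
  where
  splitAt-injective : ∀ {i j : Fin (5 + m)} → splitAt 5 i ≡ splitAt 5 j → i ≡ j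
  splitAt-injective {i} {j} eq =
    trans (sym (join-splitAt 5 m i)) (trans (cong (join 5 m) eq) (join-splitAt 5 m j))

core-arc : ∀ m x y → Tₘ m (x ↑ˡ m) (y ↑ˡ m) ≡ C₅ x y
core-arc m x y rewrite splitAt-↑ˡ 5 x m | splitAt-↑ˡ 5 y m = refl

into-core : ∀ m {w} y → Tₘ m w (y ↑ˡ m) ≡ true → ∃ λ x → w ≡ x ↑ˡ m × C₅ x y ≡ true
into-core m {w} y Dwy
  with splitAt 5 w in eq | subst (λ z → (C₅ ⊕ transitive) (splitAt 5 w) z ≡ true) (splitAt-↑ˡ 5 y m) Dwy
... | inj₁ x | Cxy = x , sym (splitAt⁻¹-↑ˡ eq) , Cxy
... | inj₂ _ | ()

lift-rescue : ∀ m {c a b e} → Rescue C₅ c a b e → Rescue (Tₘ m) (c ↑ˡ m) (a ↑ˡ m) (b ↑ˡ m) (e ↑ˡ m)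
lift-rescue m {c} {a} {b} {e} R = record
  { c≢a    = c≢a ∘ ↑ˡ-injective m c a
  ; c≢b    = c≢b ∘ ↑ˡ-injective m c b
  ; c≢e    = c≢e ∘ ↑ˡ-injective m c e
  ; a≢b    = a≢b ∘ ↑ˡ-injective m a b
  ; a≢e    = a≢e ∘ ↑ˡ-injective m a e
  ; b≢e    = b≢e ∘ ↑ˡ-injective m b e
  ; c↛b    = trans (core-arc m c b) c↛b
  ; c↛e    = trans (core-arc m c e) c↛e
  ; into-e = λ w Dwe → let x , w≡x , Cxe = into-core m e Dwe in
                      Sum.map (λ x≡a → trans w≡x (cong (_↑ˡ m) x≡a))
                              (λ x≡b → trans w≡x (cong (_↑ˡ m) x≡b)) (into-e x Cxe)
  }
  where open Rescue R

sinkSide : ∀ {m} → Fin 5 ⊎ Fin m → Bool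
sinkSide = [ (λ _ → false) , (λ _ → true) ]

isSink : ∀ {m} → Fin (5 + m) → Bool
isSink i = sinkSide (splitAt 5 i)

Sinks : ∀ m → Subset (5 + m)
Sinks m = tabulate isSink

sinks-closed : ∀ m {w u} → w ∈ Sinks m → Tₘ m w u ≡ true → u ∈ Sinks m
sinks-closed m {w} {u} w∈Sinks Dwu =
  ∈-tabulate⁺ {f = isSink} (⊕-stays (splitAt 5 w) (splitAt 5 u) (∈-tabulate⁻ {f = isSink} w∈Sinks) Dwu)
  where
  ⊕-stays : ∀ x y → sinkSide x ≡ true → (C₅ ⊕ transitive) x y ≡ true → sinkSide y ≡ true
  ⊕-stays (inj₂ _) (inj₂ _) _ _ = refl
  ⊕-stays (inj₁ _) _        () _
  ⊕-stays (inj₂ _) (inj₁ _) _  ()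

core∉Sinks : ∀ m x → x ↑ˡ m ∉ Sinks m
core∉Sinks m x x∈Sinks with trans (sym (cong sinkSide (splitAt-↑ˡ 5 x m))) (∈-tabulate⁻ {f = isSink} x∈Sinks)
... | ()

Tₘ-contains : ∀ m v → Containable (Tₘ m) 1 v (5 + m ∸ 3)
Tₘ-contains m v with splitAt 5 v in eq
... | inj₁ x = subst (λ v → Containable (Tₘ m) 1 v (5 + m ∸ 3)) (splitAt⁻¹-↑ˡ eq)
                     (rescue-contains (lift-rescue m (C₅-rescue x)) (s≤s (s≤s z≤n)))
... | inj₂ _ = closed-contains (Sinks m) (sinks-closed m) (∈-tabulate⁺ {f = isSink} (cong sinkSide eq))
                 (λ ()) (λ ()) (λ ())
                 (core∉Sinks m zero) (core∉Sinks m (suc zero)) (core∉Sinks m (suc (suc zero)))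

theorem3p5 : (n : ℕ) → 5 ≤ n → IsOrientedBeta (K n) 1 (n ∸ 3)
theorem3p5 (suc (suc (suc (suc (suc m))))) (s≤s (s≤s (s≤s (s≤s (s≤s z≤n))))) =
  orientedBeta-from-bounds {G = K (5 + m)} {f = 1} {b = 5 + m ∸ 3}
    (Tₘ m) (tournament⇒orientation (Tₘ-tournament m)) (Tₘ-contains m)
    λ D orients → tournament-unstoppable (orientation⇒tournament orients) (s≤s (s≤s z≤n))
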